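{- Let $G$ be a finite simple graph that has at least one perfect matching, let $v \in V(G)$, and let $M_1, M_2$ be perfect matchings of $G$. Then $R(M_1, v) = R(M_2, v)$.
   Context: A matching $M$ of $G$ is perfect if every vertex of $G$ is an endpoint of an edge of $M$. A walk is $M$-alternating if, for each pair of consecutive edges of the walk, exactly one of them belongs to $M$; it is $M$-$mm$-alternating if, in addition, its first and last edges belong to $M$ (vertices and edges may repeat in a walk). For a perfect matching $M$ of $G$ and $v \in V(G)$, the reachable set $R(M,v)$ is the set of vertices $u \in V(G)$ for which there exists an $M$-$mm$-alternating walk between $u$ and $v$. -}

module Defs where

open import Data.Nat using (ℕ)
open import Data.Fin using (Fin)
open import Data.Product using (_×_; ∃-syntax)
open import Relation.Nullary using (¬_)
open import Relation.Binary.PropositionalEquality using (_≡_)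
open import Level using (0ℓ; suc)

record SimpleGraph (n : ℕ) : Set₁ where
  field
    Adj      : Fin n → Fin n → Set
    symm     : ∀ {u v} → Adj u v → Adj v u
    irrefl   : ∀ {v} → ¬ Adj v v

open SimpleGraph public

record EdgeSet {n : ℕ} (G : SimpleGraph n) : Set₁ where
  field
    In      : Fin n → Fin n → Set
    In-symm : ∀ {u v} → In u v → In v u
    In-adj  : ∀ {u v} → In u v → Adj G u v

open EdgeSet public

IsMatching : ∀ {n} {G : SimpleGraph n} → EdgeSet G → Set
IsMatching M = ∀ {u v w} → In M u v → In M u w → v ≡ w

IsPerfectMatching : ∀ {n} {G : SimpleGraph n} → EdgeSet G → Set
IsPerfectMatching {n} M = IsMatching M × (∀ (v : Fin n) → ∃[ u ] In M v u)

HasPerfectMatching : ∀ {n} → SimpleGraph n → Set₁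
HasPerfectMatching G = ∃[ M ] IsPerfectMatching {G = G} M

-- M-mm-alternating walks from u to v: walks (edge sequences, repetitions
-- allowed) whose consecutive edges alternate between M and E(G) \ M and
-- whose first and last edges lie in M.
data MMWalk {n : ℕ} (G : SimpleGraph n) (M : EdgeSet G) : Fin n → Fin n → Set where
  single : ∀ {u v} → In M u v → MMWalk G M u v
  extend : ∀ {u w x y} → MMWalk G M u w → Adj G w x → ¬ In M w x → In M x y
         → MMWalk G M u y

R : ∀ {n} {G : SimpleGraph n} → EdgeSet G → Fin n → Fin n → Set
R {G = G} M v u = MMWalk G M u v

-- Let p₁, p₂ send each vertex to its partner in M₁, M₂. The permutation σ = p₁ ∘ p₂
-- has finite order, so from u the walk u, p₂ u, σ u, p₂ (σ u), σ² u, … alternates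
-- between M₂-edges and M₁-edges and returns to p₂ (σᵐ u) = p₁ u; hence every M₁-edge
-- is spanned by an M₂-mm-alternating walk. Splicing these walks along an M₁-mm-walk
-- gives an M₂-mm-walk with the same ends: where two M₂-edges would meet, the joining
-- edge is itself the last M₂-edge, which is then simply cancelled.
module Submission where

open import Defs
open import Data.Nat using (ℕ; zero; suc; s≤s) renaming (_<_ to _<ℕ_)
open import Data.Nat.GeneralisedArithmetic using (fold)
open import Data.Nat.Properties using (n<1+n)
open import Data.Fin using (Fin; toℕ; _≟_)
open import Data.Fin.Properties using (pigeonhole)
open import Data.Product using (_,_; proj₁; proj₂; ∃-syntax)
open import Function.Base using (_∘_)
open import Function.Bundles using (_⇔_; mk⇔)
open import Function.Definitions using (Injective)
import Function.Construct.Composition as Compose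
open import Relation.Nullary using (¬_; yes; no)
open import Relation.Binary.PropositionalEquality
  using (_≡_; _≢_; refl; sym; trans; cong; subst; module ≡-Reasoning)

module _ {a} {A : Set a} {f : A → A} where

  fold-shift : ∀ x k → fold (f x) f k ≡ f (fold x f k)
  fold-shift x zero    = refl
  fold-shift x (suc k) = cong f (fold-shift x k)

  fold-injective : Injective _≡_ _≡_ f → ∀ k → Injective _≡_ _≡_ (λ x → fold x f k)
  fold-injective f-injective zero    eq = eq
  fold-injective f-injective (suc k) eq = fold-injective f-injective k (f-injective eq)

module _ {n : ℕ} {f : Fin n → Fin n} (f-injective : Injective _≡_ _≡_ f) where

  injective⇒periodic : ∀ x → ∃[ m ] fold x f (suc m) ≡ x
  injective⇒periodic x
    with i , j , i<j , eq ← pigeonhole (n<1+n n) (λ (i : Fin (suc n)) → fold x f (toℕ i))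
    = cancel (toℕ i) (toℕ j) i<j eq
    where
    cancel : ∀ a b → a <ℕ b → fold x f a ≡ fold x f b → ∃[ m ] fold x f (suc m) ≡ x
    cancel zero    (suc m) _         eq = m , sym eq
    cancel (suc a) (suc b) (s≤s a<b) eq = cancel a b a<b (f-injective eq)

module _ {n : ℕ} {G : SimpleGraph n} {M : EdgeSet G} where

  MMWalk-join : ∀ {a w x y} → MMWalk G M a w → Adj G w x → ¬ In M w x →
                MMWalk G M x y → MMWalk G M a y
  MMWalk-join P e e∉M (single m)          = extend P e e∉M m
  MMWalk-join P e e∉M (extend Q e′ e′∉M m) = extend (MMWalk-join P e e∉M Q) e′ e′∉M m

module PerfectMatching {n : ℕ} {G : SimpleGraph n} (M : EdgeSet G)
                       (M-perfect : IsPerfectMatching M) where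

  mate : Fin n → Fin n
  mate v = proj₁ (proj₂ M-perfect v)

  mate-in : ∀ v → In M v (mate v)
  mate-in v = proj₂ (proj₂ M-perfect v)

  mate-unique : ∀ {v x} → In M v x → mate v ≡ x
  mate-unique = proj₁ M-perfect (mate-in _)

  mate-involutive : ∀ v → mate (mate v) ≡ v
  mate-involutive v = mate-unique (In-symm M (mate-in v))

  mate-injective : Injective _≡_ _≡_ mate
  mate-injective {x} {y} eq =
    trans (sym (mate-involutive x)) (trans (cong mate eq) (mate-involutive y))

  ∉M-if-≢mate : ∀ {w x} → mate w ≢ x → ¬ In M w x
  ∉M-if-≢mate w≢x = w≢x ∘ mate-unique

  MMWalk-cancel : ∀ {a w y} → MMWalk G M a w → MMWalk G M (mate w) y → MMWalk G M a y
  MMWalk-cancel (single m) Q =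
    subst (λ z → MMWalk G M z _) (mate-unique (In-symm M m)) Q
  MMWalk-cancel (extend P e e∉M m) Q =
    MMWalk-join P e e∉M (subst (λ z → MMWalk G M z _) (mate-unique (In-symm M m)) Q)

  MMWalk-join-adj : ∀ {a w x y} → MMWalk G M a w → Adj G w x →
                    MMWalk G M x y → MMWalk G M a y
  MMWalk-join-adj {w = w} {x} P e Q with mate w ≟ x
  ... | yes refl = MMWalk-cancel P Q
  ... | no  w≢x  = MMWalk-join P e (∉M-if-≢mate w≢x) Q

module _ {n : ℕ} {G : SimpleGraph n} (M₁ M₂ : EdgeSet G)
         (M₁-perfect : IsPerfectMatching M₁) (M₂-perfect : IsPerfectMatching M₂) where

  open PerfectMatching M₁ M₁-perfect using () renaming
    (mate to p₁; mate-in to p₁-in; mate-unique to p₁-unique;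
     mate-involutive to p₁-involutive; mate-injective to p₁-injective)
  open PerfectMatching M₂ M₂-perfect using (MMWalk-join-adj) renaming
    (mate to p₂; mate-in to p₂-in; mate-involutive to p₂-involutive;
     mate-injective to p₂-injective; ∉M-if-≢mate to ∉M₂-if-≢p₂)

  σ : Fin n → Fin n
  σ = p₁ ∘ p₂

  σ-injective : Injective _≡_ _≡_ σ
  σ-injective = Compose.injective _≡_ _≡_ _≡_ p₂-injective p₁-injective

  p₂≡p₁-if-σ≡ : ∀ {x u v} → In M₁ u v → σ x ≡ u → p₂ x ≡ v
  p₂≡p₁-if-σ≡ {x} uv∈M₁ σx≡u = begin
    p₂ x          ≡⟨ sym (p₁-involutive (p₂ x)) ⟩
    p₁ (σ x)      ≡⟨ cong p₁ σx≡u ⟩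
    p₁ _          ≡⟨ p₁-unique uv∈M₁ ⟩
    _             ∎
    where open ≡-Reasoning

  alternatingWalk : ∀ {u} → σ u ≢ u → ∀ k → MMWalk G M₂ u (p₂ (fold u σ k))
  alternatingWalk     σu≢u zero    = single (p₂-in _)
  alternatingWalk {u} σu≢u (suc k) =
    extend (alternatingWalk σu≢u k) (In-adj M₁ (p₁-in _)) (∉M₂-if-≢p₂ back-to-start) (p₂-in _)
    where
    back-to-start : p₂ (p₂ (fold u σ k)) ≢ σ (fold u σ k)
    back-to-start eq = σu≢u (fold-injective σ-injective k (begin
      fold (σ u) σ k       ≡⟨ fold-shift u k ⟩
      σ (fold u σ k)       ≡⟨ sym eq ⟩
      p₂ (p₂ (fold u σ k)) ≡⟨ p₂-involutive _ ⟩
      fold u σ k           ∎))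
      where open ≡-Reasoning

  M₁-edge⇒M₂-walk : ∀ {u v} → In M₁ u v → MMWalk G M₂ u v
  M₁-edge⇒M₂-walk {u} uv∈M₁ with σ u ≟ u
  ... | yes σu≡u = single (subst (In M₂ u) (p₂≡p₁-if-σ≡ uv∈M₁ σu≡u) (p₂-in u))
  ... | no  σu≢u with m , σᵐ⁺¹u≡u ← injective⇒periodic σ-injective u =
    subst (MMWalk G M₂ u) (p₂≡p₁-if-σ≡ uv∈M₁ σᵐ⁺¹u≡u) (alternatingWalk σu≢u m)

  MMWalk-transfer : ∀ {a b} → MMWalk G M₁ a b → MMWalk G M₂ a b
  MMWalk-transfer (single uv∈M₁)       = M₁-edge⇒M₂-walk uv∈M₁
  MMWalk-transfer (extend P e _ uv∈M₁) =
    MMWalk-join-adj (MMWalk-transfer P) e (M₁-edge⇒M₂-walk uv∈M₁)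

mainTheorem1 : ∀ {n : ℕ} (G : SimpleGraph n) → HasPerfectMatching G →
    (v : Fin n) (M₁ M₂ : EdgeSet G) →
    IsPerfectMatching M₁ → IsPerfectMatching M₂ →
    ∀ (u : Fin n) → R M₁ v u ⇔ R M₂ v u
mainTheorem1 G _ v M₁ M₂ M₁-perfect M₂-perfect u =
  mk⇔ (MMWalk-transfer M₁ M₂ M₁-perfect M₂-perfect) (MMWalk-transfer M₂ M₁ M₂-perfect M₁-perfect)
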